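{- Every prime interval graph without an infinite clique is at most countable.
   Context: Graphs are undirected without loops. A graph is an interval graph if its vertices can be assigned nonempty intervals of a chain so that two distinct vertices are adjacent iff their intervals intersect. A module of a graph $(V,E)$ is a set $A\subseteq V$ such that every vertex outside $A$ is adjacent to all or to none of the vertices of $A$; the graph is prime if its only modules are $\varnothing$, singletons and $V$. -}

module Defs where

open import Level using (Level; 0ℓ) renaming (suc to lsuc)
open import Data.Nat using (ℕ)
open import Data.Product using (Σ; ∃; _×_; _,_)
open import Data.Sum using (_⊎_)
open import Data.Empty using (⊥)
open import Data.List using (List)
open import Data.List.Membership.Propositional using (_∈_)
open import Relation.Nullary using (¬_)
open import Relation.Binary.PropositionalEquality using (_≡_)
open import Relation.Binary.Structures using (IsStrictTotalOrder)
open import Function.Bundles using (_⇔_)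
open import Function.Definitions using (Injective)

record Graph : Set₁ where
  field
    V     : Set
    E     : V → V → Set
    E-sym : ∀ {x y} → E x y → E y x
    E-irr : ∀ {x} → ¬ E x x

module _ (G : Graph) where
  open Graph G

  Subset : Set₁
  Subset = V → Set

  IsModule : Subset → Set
  IsModule A = ∀ x → ¬ A x →
    (∀ a → A a → E x a) ⊎ (∀ a → A a → ¬ E x a)

  IsEmpty : Subset → Set
  IsEmpty A = ∀ v → ¬ A v

  IsSingleton : Subset → Set
  IsSingleton A = Σ V λ v → ∀ w → A w ⇔ (w ≡ v)

  IsFull : Subset → Set
  IsFull A = ∀ v → A v

  Prime : Set₁
  Prime = ∀ (A : Subset) → IsModule A → IsEmpty A ⊎ IsSingleton A ⊎ IsFull A

  IsClique : Subset → Set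
  IsClique K = ∀ x y → K x → K y → ¬ x ≡ y → E x y

  Finite : Subset → Set
  Finite K = Σ (List V) λ xs → ∀ v → K v → v ∈ xs

  NoInfiniteClique : Set₁
  NoInfiniteClique = ¬ (Σ Subset λ K → IsClique K × ¬ Finite K)

  AtMostCountable : Set
  AtMostCountable = Σ (V → ℕ) λ f → Injective _≡_ _≡_ f

  IsInterval : {C : Set} → (C → C → Set) → (C → Set) → Set
  IsInterval {C} _<_ I = (Σ C I) × (∀ x y z → I x → I z → x < y → y < z → I y)

  IsIntervalGraph : Set₁
  IsIntervalGraph =
    Σ Set λ C → Σ (C → C → Set) λ _<_ → IsStrictTotalOrder _≡_ _<_ ×
    Σ (V → C → Set) λ I → (∀ v → IsInterval _<_ (I v)) ×
      (∀ u v → ¬ u ≡ v → E u v ⇔ (Σ C λ c → I u c × I v c))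

module Submission where

-- Represent G by intervals I v of a chain, and call z an outer neighbour of y if z is adjacent to y
-- but I z is not strictly inside I y. The outer neighbours of y form three cliques (intervals that
-- cover I y or overhang it on the left or on the right), so they are finitely many.
-- Let K be a component of the subgraph of vertices strictly inside y. Every vertex outside K that
-- is not an outer neighbour of y sees all or none of K. If an outer neighbour u of y sees some but
-- not all of K, a vertex of K seen by u next to one not seen by u sticks out of I u, so it is an
-- outer neighbour of u. Otherwise K is a module, hence a single vertex without neighbours strictly
-- inside y; two such lonely vertices with the same outer neighbours of y form a module, so there
-- are finitely many of them. Either way K contains a vertex reached from y in at most two steps,
-- each to an outer neighbour or a lonely vertex, and along an edge u v inside K, v is an outer
-- neighbour of u or strictly inside u. Strict inclusion of intervals is well founded, as a
-- descending chain is an infinite clique, so induction shows that the vertices connected to a root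
-- are generated from it by a finitely branching process, hence countably many. Finally, a prime
-- graph with more than two vertices is connected.

open import Defs
open import Level using (0ℓ; lift; lower)
open import Axiom.ExcludedMiddle using (ExcludedMiddle)
open import Axiom.DoubleNegationElimination using (em⇒dne)
open import Data.Nat as ℕ using (ℕ; zero; suc; _≤′_; ≤′-refl; ≤′-step)
open import Data.Nat.Properties using (n<1+n; m≤m⊔n; m≤n⊔m; ≤⇒≤′; <-cmp; <-irrefl)
open import Data.Fin using (toℕ)
open import Data.Fin.Properties using (pigeonhole; toℕ-injective)
open import Data.Product using (Σ; ∃; ∃₂; _×_; _,_; proj₁; proj₂)
open import Data.Sum using (_⊎_; inj₁; inj₂)
open import Data.Empty using (⊥-elim)
open import Data.List using (List; []; _∷_; _++_; length; concatMap)
open import Data.List.Membership.Propositional using (_∈_; lose; find)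
open import Data.List.Membership.Propositional.Properties
  using (∈-++⁺ˡ; ∈-++⁺ʳ; ∈-++⁻; ∈-concatMap⁺; ∈-concatMap⁻)
open import Data.List.Membership.Setoid.Properties using (index-injective)
open import Data.List.Relation.Unary.Any using (here; there; index)
open import Function using (_∘_; id)
open import Function.Bundles using (_⇔_; mk⇔; Equivalence)
open import Function.Definitions using (Injective)
open import Induction.WellFounded using (Acc; acc; WellFounded)
open import Induction.InfiniteDescent
  using (Descent; InfiniteDescent; InfiniteDescendingSequence; sequence⁺)
open import Relation.Binary.Core using (Rel)
open import Relation.Binary.Definitions using (Transitive; tri<; tri≈; tri>)
open import Relation.Binary.Structures using (IsStrictTotalOrder)
open import Relation.Binary.Construct.Closure.ReflexiveTransitive
  using (Star; ε; _◅_; _◅◅_; fold; reverse)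
open import Relation.Binary.Construct.Closure.Transitive using ([_]; transitive⁻)
open import Relation.Binary.PropositionalEquality using (_≡_; _≢_; refl; sym; trans; cong; subst; setoid)
open import Relation.Nullary using (¬_; yes; no)
open import Relation.Nullary.Decidable using (map′)
open import Relation.Unary using (Pred; _⊆_; _⊂_; _⊈_; _∪_; _∩_; ∁)
open import Relation.Unary.Properties using (⊂-trans)

open Equivalence using (to; from)

lower-em : ∀ {ℓ} → ExcludedMiddle (Level.suc ℓ) → ExcludedMiddle ℓ
lower-em lem = map′ lower lift lem

Star-preserves : ∀ {A : Set} {R : Rel A 0ℓ} {P : Pred A 0ℓ} →
                 (∀ {a b} → R a b → P a → P b) → ∀ {a b} → Star R a b → P a → P b
Star-preserves {P = P} step = fold (λ a b → P a → P b) (λ r f → f ∘ step r) id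

index-∈-++⁺ˡ : ∀ {A : Set} {a : A} {xs ys} (p : a ∈ xs) →
               toℕ (index (∈-++⁺ˡ {ys = ys} p)) ≡ toℕ (index p)
index-∈-++⁺ˡ (here _)  = refl
index-∈-++⁺ˡ (there p) = cong suc (index-∈-++⁺ˡ p)

module Generation {A : Set} (roots : List A) (next : A → List A) where

  layer : ℕ → List A
  layer zero    = roots
  layer (suc n) = layer n ++ concatMap next (layer n)

  Generated : Pred A 0ℓ
  Generated a = ∃ λ n → a ∈ layer n

  root-generated : ∀ {a} → a ∈ roots → Generated a
  root-generated a∈ = zero , a∈

  next-generated : ∀ {a b} → Generated a → b ∈ next a → Generated b
  next-generated (n , a∈) b∈ = suc n , ∈-++⁺ʳ (layer n) (∈-concatMap⁺ next (lose a∈ b∈))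

  ∈-layer-≤′ : ∀ {a m n} → m ≤′ n → (p : a ∈ layer m) →
               Σ (a ∈ layer n) λ q → toℕ (index q) ≡ toℕ (index p)
  ∈-layer-≤′ ≤′-refl         p = p , refl
  ∈-layer-≤′ (≤′-step m≤′n) p =
    let q , q≡p = ∈-layer-≤′ m≤′n p in ∈-++⁺ˡ q , trans (index-∈-++⁺ˡ q) q≡p

  position : ∀ {a} → Generated a → ℕ
  position (_ , p) = toℕ (index p)

  -- Each layer extends the previous one, so positions are comparable across layers.
  position-injective : ∀ {a b} (g : Generated a) (h : Generated b) → position g ≡ position h → a ≡ b
  position-injective (m , p) (n , q) same =
    let p′ , p′≡p = ∈-layer-≤′ (≤⇒≤′ (m≤m⊔n m n)) p
        q′ , q′≡q = ∈-layer-≤′ (≤⇒≤′ (m≤n⊔m m n)) q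
    in index-injective (setoid A) p′ q′ (toℕ-injective (trans p′≡p (trans same (sym q′≡q))))

  countable : (∀ a → Generated a) → Σ (A → ℕ) (Injective _≡_ _≡_)
  countable gen = position ∘ gen , λ {a} {b} → position-injective (gen a) (gen b)

listable⇒countable : ∀ {A : Set} → (Σ (List A) λ xs → ∀ a → a ∈ xs) → Σ (A → ℕ) (Injective _≡_ _≡_)
listable⇒countable (xs , listed) = countable (root-generated ∘ listed)
  where open Generation xs (λ _ → [])

module _ {A : Set} {_<_ : Rel A 0ℓ} where

  descent⇒infiniteDescent : ∀ {P : Pred A 0ℓ} → Descent _<_ P → InfiniteDescent _<_ P
  descent⇒infiniteDescent {P} descent {x} px = proj₁ ∘ walk , (refl , proj₁ ∘ proj₂ ∘ step) , proj₂ ∘ walk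
    where
    walk : ℕ → Σ A P
    step : ∀ n → ∃ λ y → y < proj₁ (walk n) × P y
    walk zero    = x , px
    walk (suc n) = proj₁ (step n) , proj₂ (proj₂ (step n))
    step n = descent (proj₂ (walk n))

  descending⇒ordered : ∀ {f m n} → Transitive _<_ → InfiniteDescendingSequence _<_ f → m ℕ.< n → f n < f m
  descending⇒ordered <-trans descending = transitive⁻ _<_ <-trans ∘ sequence⁺ ([_] ∘ descending)

  descending⇒injective : ∀ {f} → Transitive _<_ → (∀ {a} → ¬ a < a) → InfiniteDescendingSequence _<_ f →
                         Injective _≡_ _≡_ f
  descending⇒injective {f} <-trans irreflexive descending {m} {n} fm≡fn with <-cmp m n
  ... | tri< m<n _ _ = ⊥-elim (irreflexive (subst (f n <_) fm≡fn (descending⇒ordered <-trans descending m<n)))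
  ... | tri≈ _ m≡n _ = m≡n
  ... | tri> _ _ n<m = ⊥-elim (irreflexive (subst (_< f n) fm≡fn (descending⇒ordered <-trans descending n<m)))

injective⇒image-unlistable : ∀ {A : Set} {f : ℕ → A} → Injective _≡_ _≡_ f →
  ¬ (Σ (List A) λ xs → ∀ a → (∃ λ n → f n ≡ a) → a ∈ xs)
injective⇒image-unlistable {A} {f} f-injective (xs , listed) =
  let i , j , i<j , same = pigeonhole (n<1+n (length xs)) (index ∘ position ∘ toℕ)
  in <-irrefl (f-injective (index-injective (setoid A) (position (toℕ i)) (position (toℕ j)) same)) i<j
  where
  position : ∀ n → f n ∈ xs
  position n = listed (f n) (n , refl)

module Graphs (G : Graph) where
  open Graph G

  adj⇒≢ : ∀ {u v} → E u v → u ≢ v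
  adj⇒≢ e refl = E-irr e

  finite-⊆ : ∀ {P Q : Subset G} → Finite G Q → P ⊆ Q → Finite G P
  finite-⊆ (xs , listed) P⊆Q = xs , λ v pv → listed v (P⊆Q pv)

  finite-∪ : ∀ {P Q : Subset G} → Finite G P → Finite G Q → Finite G (P ∪ Q)
  finite-∪ (xs , xs-lists) (ys , ys-lists) = xs ++ ys , λ where
    v (inj₁ pv) → ∈-++⁺ˡ (xs-lists v pv)
    v (inj₂ qv) → ∈-++⁺ʳ xs (ys-lists v qv)

  Pair : V → V → Subset G
  Pair z z′ w = w ≡ z ⊎ w ≡ z′

  pair-elim : ∀ {P : Subset G} {z z′} → P z → P z′ → ∀ w → Pair z z′ w → P w
  pair-elim pz _   _ (inj₁ refl) = pz
  pair-elim _  pz′ _ (inj₂ refl) = pz′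

  prime-pair : Prime G → ∀ {z z′} → ¬ (∀ w → Pair z z′ w) → IsModule G (Pair z z′) → z ≡ z′
  prime-pair prime {z} {z′} not-full pair-isModule with prime (Pair z z′) pair-isModule
  ... | inj₁ empty          = ⊥-elim (empty z (inj₁ refl))
  ... | inj₂ (inj₁ (v , h)) = trans (to (h z) (inj₁ refl)) (sym (to (h z′) (inj₂ refl)))
  ... | inj₂ (inj₂ full)    = ⊥-elim (not-full full)

  connected-isModule : ∀ r → IsModule G (Star E r)
  connected-isModule r u u∉ = inj₂ λ a r→a e → u∉ (r→a ◅◅ (E-sym e ◅ ε))

  isolated⇒others-isModule : ∀ {r} → (∀ a → ¬ E r a) → IsModule G (_≢ r)
  isolated⇒others-isModule isolated u u∉ = inj₂ λ a _ e → u∉ λ u≡r → isolated a (subst (λ x → E x a) u≡r e)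

module Classical (em : ExcludedMiddle 0ℓ) where

  dne : {P : Set} → ¬ ¬ P → P
  dne = em⇒dne em

  ⊈⇒witness : ∀ {A : Set} {P Q : Pred A 0ℓ} → P ⊈ Q → ∃ λ a → P a × ¬ Q a
  ⊈⇒witness P⊈Q = dne λ none → P⊈Q λ {a} pa → dne λ ¬qa → none (a , pa , ¬qa)

  ¬acc-descent : ∀ {A : Set} {_<_ : Rel A 0ℓ} → Descent _<_ (∁ (Acc _<_))
  ¬acc-descent {x = x} ¬acc = dne λ none → ¬acc (acc λ {y} y<x → dne λ ¬acc-y → none (y , y<x , ¬acc-y))

  exit-edge : ∀ {A : Set} {R : Rel A 0ℓ} {P : Pred A 0ℓ} {a b} → Star R a b → P a → ¬ P b →
              ∃₂ λ s t → R s t × Star R t b × P s × ¬ P t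
  exit-edge ε pa ¬pb = ⊥-elim (¬pb pa)
  exit-edge {P = P} (_◅_ {j = a′} r rs) pa ¬pb with em {P a′}
  ... | yes pa′ = exit-edge rs pa′ ¬pb
  ... | no ¬pa′ = _ , a′ , r , rs , pa , ¬pa′

  module _ (G : Graph) where
    open Graph G
    open Graphs G

    clique⇒finite : NoInfiniteClique G → ∀ {K} → IsClique G K → Finite G K
    clique⇒finite no-infinite-clique {K} K-clique = dne λ infinite → no-infinite-clique (K , K-clique , infinite)

    separated⇒finite : ∀ (cs : List V) {P : Subset G} →
      (∀ {z z′} → P z → P z′ → (∀ {c} → c ∈ cs → E z c ⇔ E z′ c) → z ≡ z′) → Finite G P
    separated⇒finite [] {P} separated with em {∃ P}
    ... | yes (z , pz) = z ∷ [] , λ w pw → here (separated pw pz λ ())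
    ... | no none      = [] , λ w pw → ⊥-elim (none (w , pw))
    separated⇒finite (c ∷ cs) {P} separated =
      finite-⊆ (finite-∪ (part (λ z → E z c) λ zc z′c → mk⇔ (λ _ → z′c) (λ _ → zc))
                         (part (λ z → ¬ E z c) λ ¬zc ¬z′c → mk⇔ (⊥-elim ∘ ¬zc) (⊥-elim ∘ ¬z′c)))
               split
      where
      part : ∀ (R : Subset G) → (∀ {z z′} → R z → R z′ → E z c ⇔ E z′ c) → Finite G (P ∩ R)
      part R agree-on-c = separated⇒finite cs λ (pz , rz) (pz′ , rz′) agree → separated pz pz′ λ where
        (here refl) → agree-on-c rz rz′
        (there c∈)  → agree c∈

      split : P ⊆ (P ∩ (λ z → E z c)) ∪ (P ∩ (λ z → ¬ E z c))
      split {z} pz with em {E z c}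
      ... | yes zc = inj₁ (pz , zc)
      ... | no ¬zc = inj₂ (pz , ¬zc)

    isolated⇒listable : Prime G → ∀ {r} → (∀ a → ¬ E r a) → Σ (List V) λ xs → ∀ v → v ∈ xs
    isolated⇒listable prime {r} isolated with prime (_≢ r) (isolated⇒others-isModule isolated)
    ... | inj₁ empty          = r ∷ [] , λ v → here (dne (empty v))
    ... | inj₂ (inj₂ full)    = ⊥-elim (full r refl)
    ... | inj₂ (inj₁ (v , h)) = r ∷ v ∷ [] , listed
      where
      listed : ∀ w → w ∈ r ∷ v ∷ []
      listed w with em {w ≡ r}
      ... | yes w≡r = here w≡r
      ... | no w≢r  = there (here (to (h w) w≢r))

    prime⇒connected⊎listable : Prime G → ∀ r → (∀ x → Star E r x) ⊎ (Σ (List V) λ xs → ∀ v → v ∈ xs)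
    prime⇒connected⊎listable prime r with prime (Star E r) (connected-isModule r)
    ... | inj₁ empty          = ⊥-elim (empty r ε)
    ... | inj₂ (inj₂ full)    = inj₁ full
    ... | inj₂ (inj₁ (v , h)) = inj₂ (isolated⇒listable prime isolated)
      where
      isolated : ∀ a → ¬ E r a
      isolated a e = adj⇒≢ e (trans (to (h r) ε) (sym (to (h a) (e ◅ ε))))

    module IntervalModel
      {C : Set} {_<_ : Rel C 0ℓ} (sto : IsStrictTotalOrder _≡_ _<_)
      (I : V → C → Set) (interval : ∀ v → IsInterval G _<_ (I v))
      (adj⇔meet : ∀ u v → u ≢ v → E u v ⇔ (Σ C λ c → I u c × I v c))
      (prime : Prime G) (no-infinite-clique : NoInfiniteClique G)
      where

      open IsStrictTotalOrder sto using (compare)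

      point : ∀ v → ∃ (I v)
      point v = proj₁ (interval v)

      convex : ∀ v {a b c} → I v a → I v c → a < b → b < c → I v b
      convex v = proj₂ (interval v) _ _ _

      meet⇒adj : ∀ {u v c} → u ≢ v → I u c → I v c → E u v
      meet⇒adj {u} {v} {c} u≢v uc vc = from (adj⇔meet u v u≢v) (c , uc , vc)

      adj⇒meet : ∀ {u v} → E u v → ∃ λ c → I u c × I v c
      adj⇒meet {u} {v} e = to (adj⇔meet u v (adj⇒≢ e)) e

      below-interval : ∀ v {p q x} → I v q → ¬ I v p → p < q → I v x → p < x
      below-interval v {p} {q} {x} vq ¬vp p<q vx with compare p x
      ... | tri< p<x _ _ = p<x
      ... | tri≈ _ refl _ = ⊥-elim (¬vp vx)
      ... | tri> _ _ x<p = ⊥-elim (¬vp (convex v vx vq x<p p<q))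

      above-interval : ∀ v {p q x} → I v q → ¬ I v p → q < p → I v x → x < p
      above-interval v {p} {q} {x} vq ¬vp q<p vx with compare x p
      ... | tri< x<p _ _ = x<p
      ... | tri≈ _ refl _ = ⊥-elim (¬vp vx)
      ... | tri> _ _ p<x = ⊥-elim (¬vp (convex v vq vx q<p p<x))

      split-edge⇒⊈ : ∀ {u s t} → u ≢ t → E s t → ¬ E u t → I s ⊈ I u
      split-edge⇒⊈ u≢t st ¬ut s⊆u = let c , sc , tc = adj⇒meet st in ¬ut (meet⇒adj u≢t (s⊆u sc) tc)

      clique-by-meeting : ∀ {K : Subset G} → (∀ {a b} → K a → K b → ∃ λ c → I a c × I b c) → IsClique G K
      clique-by-meeting meeting a b ka kb a≢b = let c , ac , bc = meeting ka kb in meet⇒adj a≢b ac bc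

      _⊏_ : V → V → Set
      x ⊏ y = I x ⊂ I y

      ⊏-irrefl : ∀ {x} → ¬ x ⊏ x
      ⊏-irrefl (_ , x⊈x) = x⊈x id

      ⊏-trans : Transitive _⊏_
      ⊏-trans = ⊂-trans

      ⊏⇒adj : ∀ {x y} → x ⊏ y → E x y
      ⊏⇒adj x⊏y = let c , xc = point _ in meet⇒adj (λ { refl → ⊏-irrefl x⊏y }) xc (proj₁ x⊏y xc)

      adj-⊏⇒adj : ∀ {u x y} → x ⊏ y → E u x → u ≢ y → E u y
      adj-⊏⇒adj x⊏y e u≢y = let c , uc , xc = adj⇒meet e in meet⇒adj u≢y uc (proj₁ x⊏y xc)

      descending⇒clique : ∀ {f} → InfiniteDescendingSequence _⊏_ f → IsClique G (λ w → ∃ λ n → f n ≡ w)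
      descending⇒clique descending _ _ (m , refl) (n , refl) fm≢fn with <-cmp m n
      ... | tri< m<n _ _  = E-sym (⊏⇒adj (descending⇒ordered {_<_ = _⊏_} ⊏-trans descending m<n))
      ... | tri≈ _ refl _ = ⊥-elim (fm≢fn refl)
      ... | tri> _ _ n<m  = ⊏⇒adj (descending⇒ordered {_<_ = _⊏_} ⊏-trans descending n<m)

      ⊏-wellFounded : WellFounded _⊏_
      ⊏-wellFounded y = dne λ ¬acc →
        let f , (_ , descending) , _ = descent⇒infiniteDescent (¬acc-descent {_<_ = _⊏_}) ¬acc
            f-injective = descending⇒injective {_<_ = _⊏_} ⊏-trans ⊏-irrefl descending
        in no-infinite-clique (_ , descending⇒clique descending , injective⇒image-unlistable f-injective)

      Covers LeftOverhang RightOverhang : V → Subset G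
      Covers y z        = I y ⊆ I z
      LeftOverhang y z  = ∃₂ λ p q → p < q × I z p × ¬ I y p × I z q × I y q
      RightOverhang y z = ∃₂ λ p q → q < p × I z p × ¬ I y p × I z q × I y q

      covers-clique : ∀ y → IsClique G (Covers y)
      covers-clique y = clique-by-meeting λ y⊆a y⊆b → let c , yc = point y in c , y⊆a yc , y⊆b yc

      -- A left overhang of y contains every point of I y below its own point q there.
      leftOverhang-clique : ∀ y → IsClique G (LeftOverhang y)
      leftOverhang-clique y = clique-by-meeting meeting
        where
        meeting : ∀ {a b} → LeftOverhang y a → LeftOverhang y b → ∃ λ c → I a c × I b c
        meeting {a} {b} (p₁ , q₁ , p₁<q₁ , ap₁ , ¬yp₁ , aq₁ , yq₁) (p₂ , q₂ , p₂<q₂ , bp₂ , ¬yp₂ , bq₂ , yq₂)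
          with compare q₁ q₂
        ... | tri< q₁<q₂ _ _ = q₁ , aq₁ , convex b bp₂ bq₂ (below-interval y yq₂ ¬yp₂ p₂<q₂ yq₁) q₁<q₂
        ... | tri≈ _ refl _  = q₁ , aq₁ , bq₂
        ... | tri> _ _ q₂<q₁ = q₂ , convex a ap₁ aq₁ (below-interval y yq₁ ¬yp₁ p₁<q₁ yq₂) q₂<q₁ , bq₂

      rightOverhang-clique : ∀ y → IsClique G (RightOverhang y)
      rightOverhang-clique y = clique-by-meeting meeting
        where
        meeting : ∀ {a b} → RightOverhang y a → RightOverhang y b → ∃ λ c → I a c × I b c
        meeting {a} {b} (p₁ , q₁ , q₁<p₁ , ap₁ , ¬yp₁ , aq₁ , yq₁) (p₂ , q₂ , q₂<p₂ , bp₂ , ¬yp₂ , bq₂ , yq₂)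
          with compare q₁ q₂
        ... | tri< q₁<q₂ _ _ = q₂ , convex a aq₁ ap₁ q₁<q₂ (above-interval y yq₁ ¬yp₁ q₁<p₁ yq₂) , bq₂
        ... | tri≈ _ refl _  = q₁ , aq₁ , bq₂
        ... | tri> _ _ q₂<q₁ = q₁ , aq₁ , convex b bq₂ bp₂ q₂<q₁ (above-interval y yq₂ ¬yp₂ q₂<p₂ yq₁)

      OuterNeighbour : V → Subset G
      OuterNeighbour y z = E y z × ¬ z ⊏ y

      outerNeighbour-cases : ∀ y → OuterNeighbour y ⊆ Covers y ∪ (LeftOverhang y ∪ RightOverhang y)
      outerNeighbour-cases y {z} (e , z⋢y) with em {I y ⊆ I z}
      ... | yes y⊆z = inj₁ y⊆z
      ... | no y⊈z
        with q , yq , zq ← adj⇒meet e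
        with p , zp , ¬yp ← ⊈⇒witness (λ z⊆y → z⋢y (z⊆y , y⊈z))
        with compare p q
      ... | tri< p<q _ _ = inj₂ (inj₁ (p , q , p<q , zp , ¬yp , zq , yq))
      ... | tri≈ _ refl _ = ⊥-elim (¬yp yq)
      ... | tri> _ _ q<p = inj₂ (inj₂ (p , q , q<p , zp , ¬yp , zq , yq))

      outerNeighbour-finite : ∀ y → Finite G (OuterNeighbour y)
      outerNeighbour-finite y =
        finite-⊆ (finite-∪ (clique⇒finite no-infinite-clique (covers-clique y))
                 (finite-∪ (clique⇒finite no-infinite-clique (leftOverhang-clique y))
                           (clique⇒finite no-infinite-clique (rightOverhang-clique y))))
                 (outerNeighbour-cases y)

      outer : V → List V
      outer y = proj₁ (outerNeighbour-finite y)

      ∈-outer : ∀ {y z} → E y z → ¬ z ⊏ y → z ∈ outer y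
      ∈-outer {y} {z} e z⋢y = proj₂ (outerNeighbour-finite y) z (e , z⋢y)

      data Position (y u : V) : Set where
        is-self  : u ≡ y → Position y u
        is-inner : u ⊏ y → Position y u
        is-apart : (∀ {a} → a ⊏ y → ¬ E u a) → Position y u
        is-outer : u ∈ outer y → Position y u

      position : ∀ y u → Position y u
      position y u with em {u ≡ y} | em {u ⊏ y} | em {E y u}
      ... | yes u≡y | _        | _     = is-self u≡y
      ... | no _    | yes u⊏y  | _     = is-inner u⊏y
      ... | no _    | no u⋢y   | yes e = is-outer (∈-outer e u⋢y)
      ... | no u≢y  | no _     | no ¬e = is-apart λ a⊏y ua → ¬e (E-sym (adj-⊏⇒adj a⊏y ua u≢y))

      Lonely : V → Subset G
      Lonely y x = x ⊏ y × (∀ {w} → w ⊏ y → ¬ E x w)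

      -- Two lonely vertices of y with the same neighbours in outer y form a module.
      lonely-separated : ∀ y {z z′} → Lonely y z → Lonely y z′ →
                         (∀ {c} → c ∈ outer y → E z c ⇔ E z′ c) → z ≡ z′
      lonely-separated y {z} {z′} (z⊏y , z-lonely) (z′⊏y , z′-lonely) agree =
        prime-pair prime (λ full → ⊏-irrefl (pair-elim z⊏y z′⊏y y (full y))) pair-isModule
        where
        pair-isModule : IsModule G (Pair z z′)
        pair-isModule u _ with position y u
        ... | is-self refl   = inj₁ (pair-elim (E-sym (⊏⇒adj z⊏y)) (E-sym (⊏⇒adj z′⊏y)))
        ... | is-inner u⊏y   = inj₂ (pair-elim (z-lonely u⊏y ∘ E-sym) (z′-lonely u⊏y ∘ E-sym))
        ... | is-apart apart = inj₂ (pair-elim (apart z⊏y) (apart z′⊏y))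
        ... | is-outer u∈ with em {E u z}
        ...   | yes uz = inj₁ (pair-elim uz (E-sym (to (agree u∈) (E-sym uz))))
        ...   | no ¬uz = inj₂ (pair-elim ¬uz (¬uz ∘ E-sym ∘ from (agree u∈) ∘ E-sym))

      lonely : V → List V
      lonely y = proj₁ (separated⇒finite (outer y) (lonely-separated y))

      ∈-lonely : ∀ {y x} → Lonely y x → x ∈ lonely y
      ∈-lonely {y} {x} = proj₂ (separated⇒finite (outer y) (lonely-separated y)) x

      InnerEdge : V → Rel V 0ℓ
      InnerEdge y u v = u ⊏ y × E u v × v ⊏ y

      innerEdge-sym : ∀ {y u v} → InnerEdge y u v → InnerEdge y v u
      innerEdge-sym (u⊏y , e , v⊏y) = v⊏y , E-sym e , u⊏y

      Component : V → V → Subset G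
      Component y x w = Star (InnerEdge y) w x

      component-⊏ : ∀ {y x w} → x ⊏ y → Component y x w → w ⊏ y
      component-⊏ x⊏y ε               = x⊏y
      component-⊏ _   ((w⊏y , _) ◅ _) = w⊏y

      seeds : V → List V
      seeds y = concatMap outer (outer y) ++ lonely y

      Seeded : V → V → Set
      Seeded y x = ∃ λ s → s ∈ seeds y × Component y x s

      -- Crossing from a neighbour of u to a non-neighbour inside the component,
      -- the last neighbour s met is a seed: its interval sticks out of I u.
      split-component⇒seeded : ∀ {y x u a b} → u ∈ outer y → ¬ Component y x u →
        Component y x a → E u a → Component y x b → ¬ E u b → Seeded y x
      split-component⇒seeded {y} {x} {u} u∈ u∉ a∈ ua b∈ ¬ub =
        let s , t , st , t→b , us , ¬ut = exit-edge (a∈ ◅◅ reverse innerEdge-sym b∈) ua ¬ub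
            t∈ = t→b ◅◅ b∈
            u≢t = λ u≡t → u∉ (subst (Component y x) (sym u≡t) t∈)
            s⋢u = split-edge⇒⊈ u≢t (proj₁ (proj₂ st)) ¬ut ∘ proj₁
        in s , ∈-++⁺ˡ (∈-concatMap⁺ outer (lose u∈ (∈-outer us s⋢u))) , st ◅ t∈

      component-isModule : ∀ {y x} → x ⊏ y → ¬ Seeded y x → IsModule G (Component y x)
      component-isModule {y} {x} x⊏y unseeded u u∉ with position y u
      ... | is-self refl   = inj₁ λ a a∈ → E-sym (⊏⇒adj (component-⊏ x⊏y a∈))
      ... | is-inner u⊏y   = inj₂ λ a a∈ ua → u∉ ((u⊏y , ua , component-⊏ x⊏y a∈) ◅ a∈)
      ... | is-apart apart = inj₂ λ a a∈ → apart (component-⊏ x⊏y a∈)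
      ... | is-outer u∈ with em {∃ λ a → Component y x a × E u a} | em {∃ λ b → Component y x b × ¬ E u b}
      ...   | no none           | _                   = inj₂ λ a a∈ ua → none (a , a∈ , ua)
      ...   | yes _             | no none             = inj₁ λ b b∈ → dne λ ¬ub → none (b , b∈ , ¬ub)
      ...   | yes (a , a∈ , ua) | yes (b , b∈ , ¬ub) =
        ⊥-elim (unseeded (split-component⇒seeded u∈ u∉ a∈ ua b∈ ¬ub))

      seed : ∀ {y x} → x ⊏ y → Seeded y x
      seed {y} {x} x⊏y = dne refute
        where
        refute : ¬ ¬ Seeded y x
        refute unseeded with prime (Component y x) (component-isModule x⊏y unseeded)
        ... | inj₁ empty          = empty x ε
        ... | inj₂ (inj₂ full)    = ⊏-irrefl (component-⊏ x⊏y (full y))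
        ... | inj₂ (inj₁ (v , h)) =
          unseeded (x , ∈-++⁺ʳ (concatMap outer (outer y)) (∈-lonely (x⊏y , x-lonely)) , ε)
          where
          x-lonely : ∀ {w} → w ⊏ y → ¬ E x w
          x-lonely w⊏y xw = adj⇒≢ xw (trans (to (h x) ε) (sym (to (h _) ((w⊏y , E-sym xw , x⊏y) ◅ ε))))

      next : V → List V
      next y = outer y ++ lonely y

      module _ (r : V) where
        open Generation (r ∷ []) next

        outer-generated : ∀ {y z} → Generated y → z ∈ outer y → Generated z
        outer-generated gy z∈ = next-generated gy (∈-++⁺ˡ z∈)

        seed-generated : ∀ {y s} → Generated y → s ∈ seeds y → Generated s
        seed-generated {y} gy s∈ with ∈-++⁻ (concatMap outer (outer y)) s∈
        ... | inj₁ s∈outer² = let _ , u∈ , s∈u = find (∈-concatMap⁻ outer s∈outer²)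
                              in outer-generated (outer-generated gy u∈) s∈u
        ... | inj₂ s∈lonely = next-generated gy (∈-++⁺ʳ (outer y) s∈lonely)

        neighbour-generated : ∀ {u v} → Generated u → E u v → (v ⊏ u → Generated v) → Generated v
        neighbour-generated {u} {v} gu uv if-inner with em {v ⊏ u}
        ... | yes v⊏u = if-inner v⊏u
        ... | no v⋢u  = outer-generated gu (∈-outer uv v⋢u)

        inner-generated : ∀ {y} → Acc _⊏_ y → Generated y → ∀ {x} → x ⊏ y → Generated x
        inner-generated {y} (acc smaller) gy x⊏y =
          let s , s∈ , s→x = seed x⊏y in Star-preserves step s→x (seed-generated gy s∈)
          where
          step : ∀ {u v} → InnerEdge y u v → Generated u → Generated v
          step (u⊏y , uv , _) gu = neighbour-generated gu uv (inner-generated (smaller u⊏y) gu)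

        adjacent-generated : ∀ {u v} → E u v → Generated u → Generated v
        adjacent-generated uv gu = neighbour-generated gu uv (inner-generated (⊏-wellFounded _) gu)

        connected⇒countable : (∀ x → Star E r x) → AtMostCountable G
        connected⇒countable connected =
          countable λ x → Star-preserves adjacent-generated (connected x) (root-generated (here refl))

    prime-interval⇒countable : IsIntervalGraph G → Prime G → NoInfiniteClique G → AtMostCountable G
    prime-interval⇒countable (C , _<_ , sto , I , interval , adj⇔meet) prime no-infinite-clique with em {V}
    ... | no empty = (λ v → ⊥-elim (empty v)) , λ {v} → ⊥-elim (empty v)
    ... | yes r with prime⇒connected⊎listable prime r
    ...   | inj₁ connected = connected⇒countable r connected
      where open IntervalModel sto I interval adj⇔meet prime no-infinite-clique
    ...   | inj₂ listed    = listable⇒countable listed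

corollary5p13 : ExcludedMiddle (Level.suc 0ℓ) → (G : Graph) →
    IsIntervalGraph G → Prime G → NoInfiniteClique G → AtMostCountable G
corollary5p13 lem = prime-interval⇒countable
  where open Classical (lower-em lem)
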